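{- Let $n\ge 6$, let $D_n=\langle \sigma,\tau \mid \sigma^n=\tau^2=e,\ \tau\sigma=\sigma^{n-1}\tau\rangle$ be the dihedral group and $S=\{\sigma,\sigma^{ -1},\tau,\tau^{ -1}\}$. In the Cayley graph $\Gamma(D_n,S)$, every type A edge $\{g,g\sigma\}$ ($g\in D_n$) has Ricci curvature $\kappa=0$, and every type B edge $\{g,g\tau\}$ ($g\in D_n$) has Ricci curvature $\kappa=\frac23$.
   Context: Let $G=(V,E)$ be a finite connected simple undirected graph with graph distance $d$, $N(x)$ the set of neighbors of $x$, and $\deg(x)=|N(x)|$. For $\alpha\in[0,1]$ and $x\in V$ define the probability measure $\mu_x^\alpha$ on $V$ by $\mu_x^\alpha(x)=\alpha$, $\mu_x^\alpha(v)=\frac{1-\alpha}{\deg(x)}$ for $v\in N(x)$, and $\mu_x^\alpha(v)=0$ otherwise. For probability measures $\mu,\nu$ on $V$, the 1-Wasserstein distance is $W_1(\mu,\nu)=\inf_\pi\sum_{x,y\in V}d(x,y)\pi(x,y)$, the infimum over all $\pi:V\times V\to[0,1]$ with $\sum_y\pi(x,y)=\mu(x)$ and $\sum_x\pi(x,y)=\nu(y)$. For $x\neq y$, $\kappa_\alpha(x,y)=1-\frac{W_1(\mu_x^\alpha,\mu_y^\alpha)}{d(x,y)}$, and the Ricci curvature (of Lin–Lu–Yau) is $\kappa(x,y)=\lim_{\alpha\to1}\frac{\kappa_\alpha(x,y)}{1-\alpha}$. For a group $\mathcal G$ and a generating set $S$ with $e\notin S$ and $S=S^{ -1}$, the Cayley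 graph $\Gamma(\mathcal G,S)$ is the simple undirected graph with vertex set $\mathcal G$ and edge set $\{\{g,gs\}: g\in\mathcal G,\ s\in S\}$.
   Formalization: The parameter α ranges over the rationals in [0,1], and the limit α → 1 is taken along rational α, with the measures $\mu_x^\alpha$ and the transport plans π taking rational values. -}

module Defs where

open import Data.Bool using (Bool; true; false; _∧_; _∨_; if_then_else_; not; _xor_)
open import Data.Nat as ℕ using (ℕ; zero; suc; NonZero; _∸_)
open import Data.Nat.DivMod using (_mod_)
open import Data.Fin using (Fin; toℕ)
open import Data.List using (List; []; _∷_; map; foldr; filter; length; cartesianProduct)
open import Data.Bool.ListAction using (any)
open import Data.Fin using () renaming (_≟_ to _≟F_)
open import Data.Bool using () renaming (_≟_ to _≟B_)
open import Data.List.Membership.Propositional using (_∈_)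
open import Data.Product using (Σ; ∃; _×_; _,_; proj₁; proj₂)
open import Data.Product.Properties using (≡-dec)
open import Data.Integer using (+_)
open import Data.Rational using (ℚ; 0ℚ; 1ℚ; _+_; _-_; _*_; _≤_; _<_; _÷_; ∣_∣; _/_)
open import Data.Rational.Base using (≢-nonZero)
import Data.Rational as ℚ
open import Data.Vec.Functional using ()
open import Relation.Binary.PropositionalEquality using (_≡_)
open import Relation.Binary.Definitions using (DecidableEquality)
open import Relation.Nullary using (yes; no; ⌊_⌋)
open import Data.List using (allFin)
open import Data.List.Membership.Propositional.Properties using (∈-cartesianProduct⁺; ∈-allFin)
open import Data.List.Relation.Unary.Any using (here; there)
open import Relation.Binary.PropositionalEquality using (refl)

bools : ∀ b → b ∈ (false ∷ true ∷ [])
bools false = here refl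
bools true = there (here refl)

record FinGraph : Set₁ where
  field
    V        : Set
    _≟V_     : DecidableEquality V
    vertices : List V
    complete : ∀ v → v ∈ vertices
    adj      : V → V → Bool

module GraphNotions (G : FinGraph) where
  open FinGraph G

  reach : ℕ → V → V → Bool
  reach zero x y = ⌊ x ≟V y ⌋
  reach (suc k) x y = reach k x y ∨ any (λ z → reach k x z ∧ adj z y) vertices

  -- graph distance: least k with reach k x y (searching k ≤ |V|;
  -- for a connected graph the distance is always < |V|)
  distFrom : ℕ → ℕ → V → V → ℕ
  distFrom k zero x y = k
  distFrom k (suc fuel) x y = if reach k x y then k else distFrom (suc k) fuel x y

  dist : V → V → ℕ
  dist x y = distFrom 0 (length vertices) x y

  deg : V → ℕ
  deg x = length (filter (λ v → adj x v ≟B true) vertices)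

  -- rational division (total; q ≠ 0 in all uses below)
  _÷?_ : ℚ → ℚ → ℚ
  p ÷? q with q ℚ.≟ 0ℚ
  ... | yes _ = 0ℚ
  ... | no q≢0 = _÷_ p q {{≢-nonZero q≢0}}

  fromℕ : ℕ → ℚ
  fromℕ n = + n / 1

  μ : ℚ → V → V → ℚ
  μ α x v = if ⌊ v ≟V x ⌋ then α
            else (if adj x v then (1ℚ - α) ÷? fromℕ (deg x) else 0ℚ)

  Σ[_] : (V → ℚ) → ℚ
  Σ[ f ] = foldr (λ v s → f v + s) 0ℚ vertices

  IsCoupling : (V → ℚ) → (V → ℚ) → (V → V → ℚ) → Set
  IsCoupling μ₁ μ₂ π =
    (∀ x y → 0ℚ ≤ π x y) ×
    (∀ x → Σ[ (λ y → π x y) ] ≡ μ₁ x) ×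
    (∀ y → Σ[ (λ x → π x y) ] ≡ μ₂ y)

  cost : (V → V → ℚ) → ℚ
  cost π = Σ[ (λ x → Σ[ (λ y → fromℕ (dist x y) * π x y) ]) ]

  IsW1 : (V → ℚ) → (V → ℚ) → ℚ → Set
  IsW1 μ₁ μ₂ w =
    (∀ π → IsCoupling μ₁ μ₂ π → w ≤ cost π) ×
    (∀ ε → 0ℚ < ε → ∃ λ π → IsCoupling μ₁ μ₂ π × cost π < w + ε)

  kappaα : V → V → ℚ → ℚ
  kappaα x y w = 1ℚ - (w ÷? fromℕ (dist x y))

  -- Lin–Lu–Yau Ricci curvature: κ(x,y) = c means
  -- lim_{α→1} κ_α(x,y)/(1-α) = c  (α ranging over [0,1))
  RicciIs : V → V → ℚ → Set
  RicciIs x y c =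
    ∀ ε → 0ℚ < ε → ∃ λ δ → 0ℚ < δ ×
      (∀ α → 0ℚ ≤ α → α < 1ℚ → 1ℚ - δ < α →
        ∃ λ w → IsW1 (μ α x) (μ α y) w ×
          ∣ (kappaα x y w ÷? (1ℚ - α)) - c ∣ < ε)

record FinGroup : Set₁ where
  field
    G        : Set
    _≟G_     : DecidableEquality G
    elements : List G
    complete : ∀ g → g ∈ elements
    _·_      : G → G → G
    e        : G
    _⁻¹      : G → G

-- Cayley graph Γ(𝒢,S) for S given as a list: {g,h} is an edge iff h = g s
-- for some s ∈ S (symmetric since S = S⁻¹).
Cayley : (𝒢 : FinGroup) → List (FinGroup.G 𝒢) → FinGraph
Cayley 𝒢 S = record
  { V = G ; _≟V_ = _≟G_ ; vertices = elements ; complete = complete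
  ; adj = λ g h → any (λ s → ⌊ h ≟G (g · s) ⌋) S }
  where open FinGroup 𝒢

-- Dihedral group D_n, elements σ^i τ^b encoded as (i , b) with i : Fin n.
-- (σ^i τ^b)(σ^j τ^c) = σ^(i + (-1)^b j) τ^(b xor c)

module Dihedral (n : ℕ) .{{_ : NonZero n}} where
  D : Set
  D = Fin n × Bool

  _·_ : D → D → D
  (i , b) · (j , c) =
    ((toℕ i ℕ.+ (if b then n ∸ toℕ j else toℕ j)) mod n , b xor c)

  e : D
  e = (0 mod n , false)

  _⁻¹ : D → D
  (i , false) ⁻¹ = ((n ∸ toℕ i) mod n , false)
  (i , true) ⁻¹ = (i , true)

  σ : D
  σ = (1 mod n , false)

  τ : D
  τ = (0 mod n , true)

  DihedralGroup : FinGroup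
  DihedralGroup = record
    { G = D ; _≟G_ = ≡-dec _≟F_ _≟B_
    ; elements = cartesianProduct (allFin n) (false ∷ true ∷ [])
    ; complete = λ { (i , b) → ∈-cartesianProduct⁺ (∈-allFin i) (bools b) }
    ; _·_ = _·_ ; e = e ; _⁻¹ = _⁻¹ }

  S : List D
  S = σ ∷ (σ ⁻¹) ∷ τ ∷ (τ ⁻¹) ∷ []

  Γ : FinGraph
  Γ = Cayley DihedralGroup S

{-# OPTIONS --safe #-}
module Submission where

-- For ½ < α < 1 the distance W₁(μ_x^α, μ_y^α) is computed exactly: an
-- explicit transport plan bounds it from above, a 1-Lipschitz potential from below
-- (the easy half of Kantorovich duality). Every vertex of Γ(D_n, S) has three
-- neighbours. For an edge xy keep β = (1 − α)/3 at x and at y, move α − β from x to y,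
-- and match the other two neighbours of x with those of y, at distances k₁ and k₂. A
-- potential that grows by exactly 1, k₁ and k₂ along these moves shows that the plan is
-- optimal, so W₁ = α − β + β(k₁ + k₂) and κ(x, y) = (4 − k₁ − k₂)/3.
-- On a σ-edge (k₁, k₂) = (3, 1): up to orientation the potential is the distance along
-- the cycle ⟨σ⟩ from the neighbour of x away from y, capped at 3, plus 1 off the coset
-- of x; n ≥ 6 is what lets the cap 3 be reached. On a τ-edge (k₁, k₂) = (1, 1), with the
-- indicator of the coset of y as potential.

open import Defs
open import Data.Nat using (ℕ; NonZero; suc)
open import Data.List.Relation.Unary.Unique.Propositional using (Unique)

pattern 6+ m = suc (suc (suc (suc (suc (suc m)))))

module Rational where
  open import Level using (0ℓ)
  open import Data.Bool using (Bool; true; false; _∨_; _∧_; if_then_else_)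
  open import Data.Nat as ℕ using (ℕ)
  open import Data.Nat.Coprimality using (1-coprimeTo) renaming (sym to coprime-sym)
  open import Data.Integer as ℤ using (+_)
  import Data.Integer.Properties as ℤP
  open import Data.Rational as ℚ using (ℚ; mkℚ; 0ℚ; 1ℚ; _+_; _-_; _*_; _/_; _≤_; -_)
  import Data.Rational.Properties as ℚP
  open import Relation.Nullary.Decidable using (dec⇒maybe)
  open import Relation.Binary.PropositionalEquality
  open import Tactic.RingSolver using (solve-∀) public
  open import Tactic.RingSolver.Core.AlmostCommutativeRing using (AlmostCommutativeRing; fromCommutativeRing)

  ℚ-ring : AlmostCommutativeRing 0ℓ 0ℓ
  ℚ-ring = fromCommutativeRing ℚP.+-*-commutativeRing (λ q → dec⇒maybe (0ℚ ℚ.≟ q))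

  -- Definitionally GraphNotions.fromℕ, but available without a graph.
  fromℕ : ℕ → ℚ
  fromℕ k = + k / 1

  fromℕ≡mkℚ : ∀ k → fromℕ k ≡ mkℚ (+ k) 0 (coprime-sym (1-coprimeTo k))
  fromℕ≡mkℚ k = ℚP.↥p/↧p≡p (mkℚ (+ k) 0 (coprime-sym (1-coprimeTo k)))

  fromℕ-+ : ∀ a b → fromℕ (a ℕ.+ b) ≡ fromℕ a + fromℕ b
  fromℕ-+ a b = begin
    + (a ℕ.+ b) / 1                                  ≡⟨ ℚP./-cong {p₂ = + a ℤ.* + 1 ℤ.+ + b ℤ.* + 1} +a+b refl ⟩
    whole a + whole b                                ≡⟨ cong₂ _+_ (fromℕ≡mkℚ a) (fromℕ≡mkℚ b) ⟨
    fromℕ a + fromℕ b                                ∎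
    where
    open ≡-Reasoning
    whole : ℕ → ℚ
    whole k = mkℚ (+ k) 0 (coprime-sym (1-coprimeTo k))
    +a+b : + (a ℕ.+ b) ≡ + a ℤ.* + 1 ℤ.+ + b ℤ.* + 1
    +a+b = sym (cong₂ ℤ._+_ (ℤP.*-identityʳ (+ a)) (ℤP.*-identityʳ (+ b)))

  fromℕ-mono-≤ : ∀ {a b} → a ℕ.≤ b → fromℕ a ≤ fromℕ b
  fromℕ-mono-≤ {a} {b} a≤b = subst₂ _≤_ (sym (fromℕ≡mkℚ a)) (sym (fromℕ≡mkℚ b))
    (ℚ.*≤* (subst₂ ℤ._≤_ (sym (ℤP.*-identityʳ (+ a))) (sym (ℤP.*-identityʳ (+ b))) (ℤ.+≤+ a≤b)))

  𝟙 : Bool → ℚ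
  𝟙 true  = 1ℚ
  𝟙 false = 0ℚ

  𝟙-nonNeg : ∀ b → 0ℚ ≤ 𝟙 b
  𝟙-nonNeg true  = ℚP.nonNegative⁻¹ 1ℚ
  𝟙-nonNeg false = ℚP.≤-refl

  𝟙-∨ : ∀ p q → p ∧ q ≡ false → 𝟙 (p ∨ q) ≡ 𝟙 p + 𝟙 q
  𝟙-∨ true  false _ = sym (ℚP.+-identityʳ 1ℚ)
  𝟙-∨ false q     _ = sym (ℚP.+-identityˡ (𝟙 q))

  if-then-0 : ∀ b (c : ℚ) → (if b then c else 0ℚ) ≡ c * 𝟙 b
  if-then-0 true  c = sym (ℚP.*-identityʳ c)
  if-then-0 false c = sym (ℚP.*-zeroʳ c)

  *-nonNeg : ∀ {p q} → 0ℚ ≤ p → 0ℚ ≤ q → 0ℚ ≤ p * q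
  *-nonNeg {p} {q} 0≤p 0≤q =
    ℚP.nonNegative⁻¹ (p * q) {{ℚP.nonNeg*nonNeg⇒nonNeg p {{ℚ.nonNegative 0≤p}} q {{ℚ.nonNegative 0≤q}}}}

  p≤q⇒0≤q-p : ∀ {p q} → p ≤ q → 0ℚ ≤ q - p
  p≤q⇒0≤q-p {p} {q} p≤q = subst (_≤ q - p) (ℚP.+-inverseʳ p) (ℚP.+-monoˡ-≤ (- p) p≤q)

  +-cancelˡ-≤ : ∀ r {p q} → r + p ≤ r + q → p ≤ q
  +-cancelˡ-≤ r {p} {q} r+p≤r+q = subst₂ _≤_ (cancel r p) (cancel r q) (ℚP.+-monoʳ-≤ (- r) r+p≤r+q)
    where
    cancel : ∀ r s → - r + (r + s) ≡ s
    cancel = solve-∀ ℚ-ring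

module ListSums {A : Set} where
  open Rational
  open import Data.Bool as Bool using (Bool; true; false)
  open import Data.List using (List; []; _∷_; foldr; length; filter)
  open import Data.Rational using (ℚ; 0ℚ; 1ℚ; _+_; _*_; _≤_)
  import Data.Rational.Properties as ℚP
  open import Relation.Binary.PropositionalEquality

  sumOver : List A → (A → ℚ) → ℚ
  sumOver xs f = foldr (λ v s → f v + s) 0ℚ xs

  sumOver-cong : ∀ xs {f g : A → ℚ} → (∀ v → f v ≡ g v) → sumOver xs f ≡ sumOver xs g
  sumOver-cong []       f≗g = refl
  sumOver-cong (x ∷ xs) f≗g = cong₂ _+_ (f≗g x) (sumOver-cong xs f≗g)

  sumOver-0 : ∀ xs → sumOver xs (λ _ → 0ℚ) ≡ 0ℚ
  sumOver-0 []       = refl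
  sumOver-0 (x ∷ xs) = trans (ℚP.+-identityˡ _) (sumOver-0 xs)

  sumOver-+ : ∀ xs (f g : A → ℚ) → sumOver xs (λ v → f v + g v) ≡ sumOver xs f + sumOver xs g
  sumOver-+ []       f g = sym (ℚP.+-identityˡ 0ℚ)
  sumOver-+ (x ∷ xs) f g = trans (cong (_+_ (f x + g x)) (sumOver-+ xs f g)) (interchange (f x) (g x) _ _)
    where
    interchange : ∀ a b c d → a + b + (c + d) ≡ a + c + (b + d)
    interchange = solve-∀ ℚ-ring

  sumOver-*ˡ : ∀ xs c (f : A → ℚ) → sumOver xs (λ v → c * f v) ≡ c * sumOver xs f
  sumOver-*ˡ []       c f = sym (ℚP.*-zeroʳ c)
  sumOver-*ˡ (x ∷ xs) c f = trans (cong (_+_ (c * f x)) (sumOver-*ˡ xs c f)) (sym (ℚP.*-distribˡ-+ c (f x) _))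

  sumOver-mono-≤ : ∀ xs {f g : A → ℚ} → (∀ v → f v ≤ g v) → sumOver xs f ≤ sumOver xs g
  sumOver-mono-≤ []       f≤g = ℚP.≤-refl
  sumOver-mono-≤ (x ∷ xs) f≤g = ℚP.+-mono-≤ (f≤g x) (sumOver-mono-≤ xs f≤g)

  sumOver-comm : ∀ xs ys (F : A → A → ℚ) →
                 sumOver xs (λ u → sumOver ys (F u)) ≡ sumOver ys (λ v → sumOver xs (λ u → F u v))
  sumOver-comm []       ys F = sym (sumOver-0 ys)
  sumOver-comm (x ∷ xs) ys F = trans (cong (_+_ (sumOver ys (F x))) (sumOver-comm xs ys F))
                                     (sym (sumOver-+ ys (F x) (λ v → sumOver xs (λ u → F u v))))

  fromℕ-count : ∀ (P : A → Bool) xs →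
                fromℕ (length (filter (λ v → P v Bool.≟ true) xs)) ≡ sumOver xs (λ v → 𝟙 (P v))
  fromℕ-count P []       = refl
  fromℕ-count P (x ∷ xs) with P x
  ... | true  = trans (fromℕ-+ 1 (length (filter (λ v → P v Bool.≟ true) xs))) (cong (_+_ 1ℚ) (fromℕ-count P xs))
  ... | false = trans (fromℕ-count P xs) (sym (ℚP.+-identityˡ _))

module Transport (G : FinGraph) (vertices-unique : Unique (FinGraph.vertices G)) where
  open import Function using (_∘_)
  open import Data.Empty using (⊥-elim)
  open import Data.Bool using (true; false; T; _∨_; _∧_; if_then_else_)
  import Data.Bool.Properties as BoolP
  open import Data.Bool.Properties using (T-≡; T-∨; T-∧)
  open import Data.Nat as ℕ using (ℕ; zero; suc; z≤n; s≤s)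
  import Data.Nat.Properties as ℕP
  open import Data.Rational as ℚ using (ℚ; 0ℚ; 1ℚ; _+_; _-_; _*_; _≤_; _<_; -_; 1/_)
  import Data.Rational.Properties as ℚP
  open import Data.List using (List; []; _∷_; length; map)
  open import Data.List.Membership.Propositional using (_∈_)
  open import Data.List.Relation.Unary.Any as Any using (here; there)
  open import Data.List.Relation.Unary.Any.Properties using (any⁺; any⁻)
  open import Data.List.Relation.Unary.All as All using (All; []; _∷_)
  open import Data.List.Relation.Unary.AllPairs using (_∷_)
  open import Data.List.Relation.Unary.Unique.Propositional using (Unique)
  open import Data.Product using (∃; _×_; _,_)
  open import Data.Sum using (_⊎_; inj₁; inj₂)
  open import Function.Bundles using (module Equivalence)
  open import Relation.Nullary using (Dec; yes; no; ⌊_⌋)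
  open import Relation.Nullary.Decidable using (isYes≗does; dec-true; dec-false)
  open import Relation.Binary.PropositionalEquality
  open Rational
  open ListSums
  open Equivalence using (to; from)
  open FinGraph G
  open GraphNotions G hiding (fromℕ)

  ≟-refl : ∀ v → ⌊ v ≟V v ⌋ ≡ true
  ≟-refl v = trans (isYes≗does (v ≟V v)) (dec-true (v ≟V v) refl)

  ≟-≢ : ∀ {u v} → u ≢ v → ⌊ u ≟V v ⌋ ≡ false
  ≟-≢ {u} {v} u≢v = trans (isYes≗does (u ≟V v)) (dec-false (u ≟V v) u≢v)

  distℚ : V → V → ℚ
  distℚ u v = fromℕ (dist u v)

  𝟙[_] : V → V → ℚ
  𝟙[ p ] v = 𝟙 ⌊ v ≟V p ⌋

  𝟙[]-self : ∀ p → 𝟙[ p ] p ≡ 1ℚ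
  𝟙[]-self p = cong 𝟙 (≟-refl p)

  𝟙[]-≢ : ∀ {p v} → v ≢ p → 𝟙[ p ] v ≡ 0ℚ
  𝟙[]-≢ v≢p = cong 𝟙 (≟-≢ v≢p)

  sumOver-𝟙-absent : ∀ {p} xs (f : V → ℚ) → All (p ≢_) xs → sumOver xs (λ v → f v * 𝟙[ p ] v) ≡ 0ℚ
  sumOver-𝟙-absent []       f []            = refl
  sumOver-𝟙-absent {p} (x ∷ xs) f (p≢x ∷ p≢xs) = begin
    f x * 𝟙[ p ] x + sumOver xs (λ v → f v * 𝟙[ p ] v)
      ≡⟨ cong₂ _+_ (cong (f x *_) (𝟙[]-≢ (p≢x ∘ sym))) (sumOver-𝟙-absent xs f p≢xs) ⟩
    f x * 0ℚ + 0ℚ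
      ≡⟨ trans (ℚP.+-identityʳ _) (ℚP.*-zeroʳ (f x)) ⟩
    0ℚ ∎
    where open ≡-Reasoning

  sumOver-𝟙 : ∀ {p} xs (f : V → ℚ) → Unique xs → p ∈ xs → sumOver xs (λ v → f v * 𝟙[ p ] v) ≡ f p
  sumOver-𝟙 (x ∷ xs) f (x≢xs ∷ _) (here refl) = begin
    f x * 𝟙[ x ] x + sumOver xs (λ v → f v * 𝟙[ x ] v)
      ≡⟨ cong₂ _+_ (cong (f x *_) (𝟙[]-self x)) (sumOver-𝟙-absent xs f x≢xs) ⟩
    f x * 1ℚ + 0ℚ
      ≡⟨ trans (ℚP.+-identityʳ _) (ℚP.*-identityʳ (f x)) ⟩
    f x ∎
    where open ≡-Reasoning
  sumOver-𝟙 {p} (x ∷ xs) f (x≢xs ∷ xs-unique) (there p∈xs) = begin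
    f x * 𝟙[ p ] x + sumOver xs (λ v → f v * 𝟙[ p ] v)
      ≡⟨ cong₂ _+_ (cong (f x *_) (𝟙[]-≢ (All.lookup x≢xs p∈xs))) (sumOver-𝟙 xs f xs-unique p∈xs) ⟩
    f x * 0ℚ + f p
      ≡⟨ trans (cong (λ z → z + f p) (ℚP.*-zeroʳ (f x))) (ℚP.+-identityˡ (f p)) ⟩
    f p ∎
    where open ≡-Reasoning

  Σ-𝟙 : ∀ p (f : V → ℚ) → Σ[ (λ v → f v * 𝟙[ p ] v) ] ≡ f p
  Σ-𝟙 p f = sumOver-𝟙 vertices f vertices-unique (complete p)

  Measure : Set
  Measure = List (V × ℚ)

  density : Measure → V → ℚ
  density []             v = 0ℚ
  density ((p , c) ∷ ms) v = c * 𝟙[ p ] v + density ms v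

  expectation : (V → ℚ) → Measure → ℚ
  expectation f []             = 0ℚ
  expectation f ((p , c) ∷ ms) = c * f p + expectation f ms

  Σ-*-density : ∀ (f : V → ℚ) ms → Σ[ (λ v → f v * density ms v) ] ≡ expectation f ms
  Σ-*-density f []             = trans (sumOver-cong vertices (λ v → ℚP.*-zeroʳ (f v))) (sumOver-0 vertices)
  Σ-*-density f ((p , c) ∷ ms) = begin
    Σ[ (λ v → f v * (c * 𝟙[ p ] v + density ms v)) ]
      ≡⟨ sumOver-cong vertices (λ v → distrib (f v) c (𝟙[ p ] v) (density ms v)) ⟩
    Σ[ (λ v → c * f v * 𝟙[ p ] v + f v * density ms v) ]
      ≡⟨ sumOver-+ vertices (λ v → c * f v * 𝟙[ p ] v) (λ v → f v * density ms v) ⟩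
    Σ[ (λ v → c * f v * 𝟙[ p ] v) ] + Σ[ (λ v → f v * density ms v) ]
      ≡⟨ cong₂ _+_ (Σ-𝟙 p (λ v → c * f v)) (Σ-*-density f ms) ⟩
    c * f p + expectation f ms ∎
    where
    open ≡-Reasoning
    distrib : ∀ a c e d → a * (c * e + d) ≡ c * a * e + a * d
    distrib = solve-∀ ℚ-ring

  Plan : Set
  Plan = List (V × V × ℚ)

  ⟦_⟧ : Plan → V → V → ℚ
  ⟦ []                ⟧ u v = 0ℚ
  ⟦ (p , q , c) ∷ ps ⟧ u v = c * 𝟙[ p ] u * 𝟙[ q ] v + ⟦ ps ⟧ u v

  sources targets : Plan → Measure
  sources = map λ { (p , q , c) → (p , c) }
  targets = map λ { (p , q , c) → (q , c) }

  transportCost : Plan → ℚ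
  transportCost []                = 0ℚ
  transportCost ((p , q , c) ∷ ps) = distℚ p q * c + transportCost ps

  NonNegWeights : Plan → Set
  NonNegWeights = All λ { (p , q , c) → 0ℚ ≤ c }

  ⟦⟧-nonNeg : ∀ ps → NonNegWeights ps → ∀ u v → 0ℚ ≤ ⟦ ps ⟧ u v
  ⟦⟧-nonNeg []                 []             u v = ℚP.≤-refl
  ⟦⟧-nonNeg ((p , q , c) ∷ ps) (0≤c ∷ ps≥0) u v =
    ℚP.+-mono-≤ (*-nonNeg (*-nonNeg 0≤c (𝟙-nonNeg ⌊ u ≟V p ⌋)) (𝟙-nonNeg ⌊ v ≟V q ⌋)) (⟦⟧-nonNeg ps ps≥0 u v)

  Σ-⟦⟧-sources : ∀ ps u → Σ[ ⟦ ps ⟧ u ] ≡ density (sources ps) u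
  Σ-⟦⟧-sources []                 u = sumOver-0 vertices
  Σ-⟦⟧-sources ((p , q , c) ∷ ps) u =
    trans (sumOver-+ vertices (λ v → c * 𝟙[ p ] u * 𝟙[ q ] v) (⟦ ps ⟧ u))
          (cong₂ _+_ (Σ-𝟙 q (λ _ → c * 𝟙[ p ] u)) (Σ-⟦⟧-sources ps u))

  Σ-⟦⟧-targets : ∀ ps v → Σ[ (λ u → ⟦ ps ⟧ u v) ] ≡ density (targets ps) v
  Σ-⟦⟧-targets []                 v = sumOver-0 vertices
  Σ-⟦⟧-targets ((p , q , c) ∷ ps) v =
    trans (sumOver-+ vertices (λ u → c * 𝟙[ p ] u * 𝟙[ q ] v) (λ u → ⟦ ps ⟧ u v))
          (cong₂ _+_ (trans (sumOver-cong vertices (λ u → swap c (𝟙[ p ] u) (𝟙[ q ] v))) (Σ-𝟙 p (λ _ → c * 𝟙[ q ] v)))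
                     (Σ-⟦⟧-targets ps v))
    where
    swap : ∀ c e d → c * e * d ≡ c * d * e
    swap = solve-∀ ℚ-ring

  cost-⟦⟧ : ∀ ps → cost ⟦ ps ⟧ ≡ transportCost ps
  cost-⟦⟧ [] = trans (sumOver-cong vertices (λ u → no-cost u)) (sumOver-0 vertices)
    where
    no-cost : ∀ u → Σ[ (λ v → distℚ u v * 0ℚ) ] ≡ 0ℚ
    no-cost u = trans (sumOver-cong vertices (λ v → ℚP.*-zeroʳ (distℚ u v))) (sumOver-0 vertices)
  cost-⟦⟧ ((p , q , c) ∷ ps) = begin
    cost ⟦ (p , q , c) ∷ ps ⟧
      ≡⟨ sumOver-cong vertices (λ u → trans (sumOver-cong vertices (λ v → ℚP.*-distribˡ-+ (d u v) (head u v) (⟦ ps ⟧ u v)))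
                                            (sumOver-+ vertices (λ v → d u v * head u v) (λ v → d u v * ⟦ ps ⟧ u v))) ⟩
    Σ[ (λ u → Σ[ (λ v → d u v * head u v) ] + Σ[ (λ v → d u v * ⟦ ps ⟧ u v) ]) ]
      ≡⟨ sumOver-+ vertices (λ u → Σ[ (λ v → d u v * head u v) ]) (λ u → Σ[ (λ v → d u v * ⟦ ps ⟧ u v) ]) ⟩
    Σ[ (λ u → Σ[ (λ v → d u v * head u v) ]) ] + cost ⟦ ps ⟧
      ≡⟨ cong₂ _+_ head-cost (cost-⟦⟧ ps) ⟩
    d p q * c + transportCost ps ∎
    where
    open ≡-Reasoning
    d : V → V → ℚ
    d = distℚ
    head : V → V → ℚ
    head u v = c * 𝟙[ p ] u * 𝟙[ q ] v
    regroup : ∀ d c e f → d * (c * e * f) ≡ d * c * e * f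
    regroup = solve-∀ ℚ-ring
    head-cost : Σ[ (λ u → Σ[ (λ v → d u v * head u v) ]) ] ≡ d p q * c
    head-cost = trans (sumOver-cong vertices row) (Σ-𝟙 p (λ u → d u q * c))
      where
      row : ∀ u → Σ[ (λ v → d u v * head u v) ] ≡ d u q * c * 𝟙[ p ] u
      row u = trans (sumOver-cong vertices (λ v → regroup (d u v) c (𝟙[ p ] u) (𝟙[ q ] v)))
                    (Σ-𝟙 q (λ v → d u v * c * 𝟙[ p ] u))

  kantorovich : ∀ {μ₁ μ₂ π} (f : V → ℚ) → (∀ u v → f v ≤ f u + distℚ u v) → IsCoupling μ₁ μ₂ π →
                Σ[ (λ v → f v * μ₂ v) ] ≤ Σ[ (λ u → f u * μ₁ u) ] + cost π
  kantorovich {μ₁} {μ₂} {π} f f-lip (π≥0 , rows , cols) = begin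
    Σ[ (λ v → f v * μ₂ v) ]
      ≡⟨ sumOver-cong vertices (λ v → trans (cong (f v *_) (sym (cols v))) (sym (sumOver-*ˡ vertices (f v) (λ u → π u v)))) ⟩
    Σ[ (λ v → Σ[ (λ u → f v * π u v) ]) ]
      ≡⟨ sumOver-comm vertices vertices (λ u v → f v * π u v) ⟨
    Σ[ (λ u → Σ[ (λ v → f v * π u v) ]) ]
      ≤⟨ sumOver-mono-≤ vertices (λ u → sumOver-mono-≤ vertices (λ v →
           ℚP.*-monoʳ-≤-nonNeg (π u v) {{ℚ.nonNegative (π≥0 u v)}} (f-lip u v))) ⟩
    Σ[ (λ u → Σ[ (λ v → (f u + d u v) * π u v) ]) ]
      ≡⟨ sumOver-cong vertices (λ u → trans (sumOver-cong vertices (λ v → ℚP.*-distribʳ-+ (π u v) (f u) (d u v)))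
                                            (sumOver-+ vertices (λ v → f u * π u v) (λ v → d u v * π u v))) ⟩
    Σ[ (λ u → Σ[ (λ v → f u * π u v) ] + Σ[ (λ v → d u v * π u v) ]) ]
      ≡⟨ sumOver-+ vertices (λ u → Σ[ (λ v → f u * π u v) ]) (λ u → Σ[ (λ v → d u v * π u v) ]) ⟩
    Σ[ (λ u → Σ[ (λ v → f u * π u v) ]) ] + cost π
      ≡⟨ cong (λ s → s + cost π) (sumOver-cong vertices (λ u →
           trans (sumOver-*ˡ vertices (f u) (π u)) (cong (f u *_) (rows u)))) ⟩
    Σ[ (λ u → f u * μ₁ u) ] + cost π ∎
    where
    open ℚP.≤-Reasoning
    d : V → V → ℚ
    d = distℚ

  isW1-of-plan : ∀ {μ₁ μ₂} w (ps : Plan) (f : V → ℚ) →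
                 NonNegWeights ps → (∀ u → density (sources ps) u ≡ μ₁ u) → (∀ v → density (targets ps) v ≡ μ₂ v) →
                 transportCost ps ≤ w →
                 (∀ u v → f v ≤ f u + distℚ u v) → Σ[ (λ u → f u * μ₁ u) ] + w ≤ Σ[ (λ v → f v * μ₂ v) ] →
                 IsW1 μ₁ μ₂ w
  isW1-of-plan {μ₁} w ps f ps≥0 srcs tgts cost≤w f-lip gap≥w =
    (λ π coupling → +-cancelˡ-≤ Σ[ (λ u → f u * μ₁ u) ] (ℚP.≤-trans gap≥w (kantorovich f f-lip coupling))) ,
    λ ε ε>0 → ⟦ ps ⟧ ,
      (⟦⟧-nonNeg ps ps≥0 , (λ u → trans (Σ-⟦⟧-sources ps u) (srcs u)) , (λ v → trans (Σ-⟦⟧-targets ps v) (tgts v))) ,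
      ℚP.≤-<-trans (subst (_≤ w) (sym (cost-⟦⟧ ps)) cost≤w) (subst (_< w + ε) (ℚP.+-identityʳ w) (ℚP.+-monoʳ-< w ε>0))

  reach-step : ∀ {k u w v} → reach k u w ≡ true → adj w v ≡ true → reach (suc k) u v ≡ true
  reach-step {k} {u} {w} {v} u↝w w~v = to T-≡ (from T-∨ (inj₂ (any⁺ (λ z → reach k u z ∧ adj z v) via-w)))
    where
    via-w : Any.Any (λ z → T (reach k u z ∧ adj z v)) vertices
    via-w = Any.map (λ { refl → from T-∧ (from T-≡ u↝w , from T-≡ w~v) }) (complete w)

  reach-last-step : ∀ {k u v} → reach (suc k) u v ≡ true →
                    reach k u v ≡ true ⊎ ∃ λ w → reach k u w ≡ true × adj w v ≡ true
  reach-last-step {k} {u} {v} u↝v with to T-∨ (from T-≡ u↝v)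
  ... | inj₁ u↝ᵏv = inj₁ (to T-≡ u↝ᵏv)
  ... | inj₂ via with Any.satisfied (any⁻ (λ z → reach k u z ∧ adj z v) vertices via)
  ...   | w , u↝w∧w~v with to T-∧ u↝w∧w~v
  ...     | u↝w , w~v = inj₂ (w , to T-≡ u↝w , to T-≡ w~v)

  distFrom-≤ : ∀ {k u v} → reach k u v ≡ true →
               ∀ j fuel → j ℕ.≤ k → k ℕ.≤ j ℕ.+ fuel → distFrom j fuel u v ℕ.≤ k
  distFrom-≤ u↝v j zero       j≤k k≤j+0 = j≤k
  distFrom-≤ {k} {u} {v} u↝v j (suc fuel) j≤k k≤j+fuel with reach j u v in u↝ʲv
  ... | true  = j≤k
  ... | false = distFrom-≤ u↝v (suc j) fuel (ℕP.≤∧≢⇒< j≤k j≢k) (subst (k ℕ.≤_) (ℕP.+-suc j fuel) k≤j+fuel)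
    where
    j≢k : j ≢ k
    j≢k refl with () ← trans (sym u↝ʲv) u↝v

  data Walk : V → ℕ → V → Set where
    [_]  : ∀ u → Walk u 0 u
    step : ∀ {u k w} → Walk u k w → ∀ v → adj w v ≡ true → Walk u (suc k) v

  infixl 5 step
  syntax step walk v w~v = walk —[ w~v ]→ v

  walk⇒reach : ∀ {u k v} → Walk u k v → reach k u v ≡ true
  walk⇒reach [ u ]                        = ≟-refl u
  walk⇒reach (step {u} {k} walk v w~v) = reach-step {k} {u} (walk⇒reach walk) w~v

  dist-≤-walk : ∀ {u k v} → Walk u k v → k ℕ.≤ length vertices → dist u v ℕ.≤ k
  dist-≤-walk walk k≤|V| = distFrom-≤ (walk⇒reach walk) 0 (length vertices) z≤n k≤|V|

  dist-self : ∀ u → dist u u ≡ 0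
  dist-self u = ℕP.n≤0⇒n≡0 (dist-≤-walk [ u ] z≤n)

  dist-adj-≤ : ∀ u v → adj u v ≡ true → dist u v ℕ.≤ 1
  dist-adj-≤ u v u~v = dist-≤-walk ([ u ] —[ u~v ]→ v) (nonEmpty (complete u))
    where
    nonEmpty : ∀ {xs} → u ∈ xs → 1 ℕ.≤ length xs
    nonEmpty (here _)  = s≤s z≤n
    nonEmpty (there _) = s≤s z≤n

  module _ (φ : V → ℕ) (φ-edge : ∀ {u v} → adj u v ≡ true → φ v ℕ.≤ suc (φ u))
           (φ-bounded : ∀ v → φ v ℕ.≤ length vertices) where

    reach⇒φ-≤ : ∀ k {u v} → reach k u v ≡ true → φ v ℕ.≤ φ u ℕ.+ k
    reach⇒φ-≤ zero {u} {v} u↝v with u ≟V v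
    ... | yes refl = ℕP.m≤m+n (φ u) 0
    reach⇒φ-≤ (suc k) {u} {v} u↝v with reach-last-step {k} {u} u↝v
    ... | inj₁ u↝ᵏv = ℕP.≤-trans (reach⇒φ-≤ k u↝ᵏv) (ℕP.+-monoʳ-≤ (φ u) (ℕP.n≤1+n k))
    ... | inj₂ (w , u↝w , w~v) = begin
      φ v               ≤⟨ φ-edge w~v ⟩
      suc (φ w)         ≤⟨ s≤s (reach⇒φ-≤ k u↝w) ⟩
      suc (φ u ℕ.+ k)   ≡⟨ ℕP.+-suc (φ u) k ⟨
      φ u ℕ.+ suc k     ∎
      where open ℕP.≤-Reasoning

    distFrom⇒φ-≤ : ∀ j fuel {u v} → φ v ℕ.≤ φ u ℕ.+ (j ℕ.+ fuel) → φ v ℕ.≤ φ u ℕ.+ distFrom j fuel u v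
    distFrom⇒φ-≤ j zero {u} {v} φv≤ = subst (λ d → φ v ℕ.≤ φ u ℕ.+ d) (ℕP.+-identityʳ j) φv≤
    distFrom⇒φ-≤ j (suc fuel) {u} {v} φv≤ with reach j u v in u↝ʲv
    ... | true  = reach⇒φ-≤ j u↝ʲv
    ... | false = distFrom⇒φ-≤ (suc j) fuel (subst (λ d → φ v ℕ.≤ φ u ℕ.+ d) (ℕP.+-suc j fuel) φv≤)

    φ-≤-dist : ∀ u v → φ v ℕ.≤ φ u ℕ.+ dist u v
    φ-≤-dist u v = distFrom⇒φ-≤ 0 (length vertices) (ℕP.≤-trans (φ-bounded v) (ℕP.m≤n+m (length vertices) (φ u)))

  β : ℚ → ℚ
  β α = (1ℚ - α) ÷? fromℕ 3

  record NeighbourhoodIs (x a b c : V) : Set where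
    field
      adj≡ : ∀ v → adj x v ≡ ⌊ v ≟V a ⌋ ∨ ⌊ v ≟V b ⌋ ∨ ⌊ v ≟V c ⌋
      x≢a  : x ≢ a
      x≢b  : x ≢ b
      x≢c  : x ≢ c
      a≢b  : a ≢ b
      a≢c  : a ≢ c
      b≢c  : b ≢ c

  module _ {x a b c : V} (N : NeighbourhoodIs x a b c) where
    open NeighbourhoodIs N

    swap₁₂ : NeighbourhoodIs x b a c
    swap₁₂ = record
      { adj≡ = λ v → trans (adj≡ v) (swap ⌊ v ≟V a ⌋ ⌊ v ≟V b ⌋ ⌊ v ≟V c ⌋)
      ; x≢a = x≢b ; x≢b = x≢a ; x≢c = x≢c ; a≢b = a≢b ∘ sym ; a≢c = b≢c ; b≢c = a≢c }
      where
      swap : ∀ p q r → p ∨ q ∨ r ≡ q ∨ p ∨ r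
      swap p q r = trans (sym (BoolP.∨-assoc p q r)) (trans (cong (_∨ r) (BoolP.∨-comm p q)) (BoolP.∨-assoc q p r))

    rotate : NeighbourhoodIs x c a b
    rotate = record
      { adj≡ = λ v → trans (adj≡ v) (rot ⌊ v ≟V a ⌋ ⌊ v ≟V b ⌋ ⌊ v ≟V c ⌋)
      ; x≢a = x≢c ; x≢b = x≢a ; x≢c = x≢b ; a≢b = a≢c ∘ sym ; a≢c = b≢c ∘ sym ; b≢c = a≢b }
      where
      rot : ∀ p q r → p ∨ q ∨ r ≡ r ∨ p ∨ q
      rot p q r = trans (sym (BoolP.∨-assoc p q r)) (BoolP.∨-comm (p ∨ q) r)

    adj-first : adj x a ≡ true
    adj-first = trans (adj≡ a) (cong (_∨ (⌊ a ≟V b ⌋ ∨ ⌊ a ≟V c ⌋)) (≟-refl a))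

    adj⇒neighbour : ∀ {v} → adj x v ≡ true → v ≡ a ⊎ v ≡ b ⊎ v ≡ c
    adj⇒neighbour {v} x~v with v ≟V a | v ≟V b | v ≟V c | trans (sym (adj≡ v)) x~v
    ... | yes v≡a | _        | _        | _ = inj₁ v≡a
    ... | no _    | yes v≡b  | _        | _ = inj₂ (inj₁ v≡b)
    ... | no _    | no _     | yes v≡c  | _ = inj₂ (inj₂ v≡c)
    ... | no _    | no _     | no _     | ()

    𝟙-adj : ∀ v → 𝟙 (adj x v) ≡ 𝟙[ a ] v + (𝟙[ b ] v + 𝟙[ c ] v)
    𝟙-adj v = begin
      𝟙 (adj x v)
        ≡⟨ cong 𝟙 (adj≡ v) ⟩
      𝟙 (⌊ v ≟V a ⌋ ∨ ⌊ v ≟V b ⌋ ∨ ⌊ v ≟V c ⌋)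
        ≡⟨ 𝟙-∨ ⌊ v ≟V a ⌋ _ a-disjoint ⟩
      𝟙[ a ] v + 𝟙 (⌊ v ≟V b ⌋ ∨ ⌊ v ≟V c ⌋)
        ≡⟨ cong (_+_ (𝟙[ a ] v)) (𝟙-∨ ⌊ v ≟V b ⌋ ⌊ v ≟V c ⌋ (≟-disjoint b≢c)) ⟩
      𝟙[ a ] v + (𝟙[ b ] v + 𝟙[ c ] v) ∎
      where
      open ≡-Reasoning
      ≟-disjoint : ∀ {p q} → p ≢ q → ⌊ v ≟V p ⌋ ∧ ⌊ v ≟V q ⌋ ≡ false
      ≟-disjoint {p} p≢q with v ≟V p
      ... | yes refl = ≟-≢ p≢q
      ... | no _     = refl
      a-disjoint : ⌊ v ≟V a ⌋ ∧ (⌊ v ≟V b ⌋ ∨ ⌊ v ≟V c ⌋) ≡ false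
      a-disjoint = trans (BoolP.∧-distribˡ-∨ ⌊ v ≟V a ⌋ _ _) (cong₂ _∨_ (≟-disjoint a≢b) (≟-disjoint a≢c))

    deg-three : fromℕ (deg x) ≡ fromℕ 3
    deg-three = begin
      fromℕ (deg x)
        ≡⟨ fromℕ-count (adj x) vertices ⟩
      Σ[ (λ v → 𝟙 (adj x v)) ]
        ≡⟨ sumOver-cong vertices 𝟙-adj ⟩
      Σ[ (λ v → 𝟙[ a ] v + (𝟙[ b ] v + 𝟙[ c ] v)) ]
        ≡⟨ sumOver-+ vertices 𝟙[ a ] (λ v → 𝟙[ b ] v + 𝟙[ c ] v) ⟩
      Σ[ 𝟙[ a ] ] + Σ[ (λ v → 𝟙[ b ] v + 𝟙[ c ] v) ]
        ≡⟨ cong (_+_ Σ[ 𝟙[ a ] ]) (sumOver-+ vertices 𝟙[ b ] 𝟙[ c ]) ⟩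
      Σ[ 𝟙[ a ] ] + (Σ[ 𝟙[ b ] ] + Σ[ 𝟙[ c ] ])
        ≡⟨ cong₂ _+_ (Σ-𝟙[] a) (cong₂ _+_ (Σ-𝟙[] b) (Σ-𝟙[] c)) ⟩
      1ℚ + (1ℚ + 1ℚ) ∎
      where
      open ≡-Reasoning
      Σ-𝟙[] : ∀ p → Σ[ 𝟙[ p ] ] ≡ 1ℚ
      Σ-𝟙[] p = trans (sumOver-cong vertices (λ v → sym (ℚP.*-identityˡ (𝟙[ p ] v)))) (Σ-𝟙 p (λ _ → 1ℚ))

    measure : ℚ → Measure
    measure α = (x , α) ∷ (a , β α) ∷ (b , β α) ∷ (c , β α) ∷ []

    μ-neighbourhood : ∀ α v → μ α x v ≡ density (measure α) v
    μ-neighbourhood α v =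
      trans (cong (λ d → if ⌊ v ≟V x ⌋ then α else (if adj x v then (1ℚ - α) ÷? d else 0ℚ)) deg-three) (split (v ≟V x))
      where
      at-x : ∀ α β → α ≡ α * 1ℚ + (β * 0ℚ + (β * 0ℚ + (β * 0ℚ + 0ℚ)))
      at-x = solve-∀ ℚ-ring
      off-x : ∀ α β A B C → β * (A + (B + C)) ≡ α * 0ℚ + (β * A + (β * B + (β * C + 0ℚ)))
      off-x = solve-∀ ℚ-ring
      split : (v≟x : Dec (v ≡ x)) →
              (if ⌊ v≟x ⌋ then α else (if adj x v then β α else 0ℚ)) ≡
              α * 𝟙 ⌊ v≟x ⌋ + (β α * 𝟙[ a ] v + (β α * 𝟙[ b ] v + (β α * 𝟙[ c ] v + 0ℚ)))
      split (yes refl) = trans (at-x α (β α))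
        (cong₂ (λ p q → α * 1ℚ + (β α * p + q)) (sym (𝟙[]-≢ x≢a))
          (cong₂ (λ p q → β α * p + (β α * q + 0ℚ)) (sym (𝟙[]-≢ x≢b)) (sym (𝟙[]-≢ x≢c))))
      split (no _) = trans (if-then-0 (adj x v) (β α))
        (trans (cong (β α *_) (𝟙-adj v)) (off-x α (β α) (𝟙[ a ] v) (𝟙[ b ] v) (𝟙[ c ] v)))

    Σ-*-μ : ∀ (f : V → ℚ) α → Σ[ (λ v → f v * μ α x v) ] ≡ expectation f (measure α)
    Σ-*-μ f α = trans (sumOver-cong vertices (λ v → cong (f v *_) (μ-neighbourhood α v))) (Σ-*-density f (measure α))

  ½ : ℚ
  ½ = 1/ fromℕ 2

  ricciIs-of-exact : ∀ x y c →
    (∀ α → ½ < α → α < 1ℚ → ∃ λ w → IsW1 (μ α x) (μ α y) w × kappaα x y w ÷? (1ℚ - α) ≡ c) →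
    RicciIs x y c
  ricciIs-of-exact x y c exact ε ε>0 = ½ , ℚP.positive⁻¹ ½ , near-1
    where
    near-1 : ∀ α → 0ℚ ≤ α → α < 1ℚ → 1ℚ - ½ < α →
             ∃ λ w → IsW1 (μ α x) (μ α y) w × ℚ.∣ kappaα x y w ÷? (1ℚ - α) - c ∣ < ε
    near-1 α _ α<1 ½<α with exact α ½<α α<1
    ... | w , w-isW1 , κ≡c = w , w-isW1 , subst (λ κ → ℚ.∣ κ - c ∣ < ε) (sym κ≡c)
                                                 (subst (λ z → ℚ.∣ z ∣ < ε) (sym (ℚP.+-inverseʳ c)) ε>0)

  ÷?-cancelʳ : ∀ c q → q ≢ 0ℚ → (c * q) ÷? q ≡ c
  ÷?-cancelʳ c q q≢0 with q ℚ.≟ 0ℚ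
  ... | yes q≡0 = ⊥-elim (q≢0 q≡0)
  ... | no  q≢0 = trans (ℚP.*-assoc c q (1/ q)) (trans (cong (c *_) (ℚP.*-inverseʳ q)) (ℚP.*-identityʳ c))
    where instance _ = ℚ.≢-nonZero q≢0

  ⅓ : ℚ
  ⅓ = 1/ fromℕ 3

  β-nonNeg : ∀ {α} → α < 1ℚ → 0ℚ ≤ β α
  β-nonNeg α<1 = *-nonNeg (p≤q⇒0≤q-p (ℚP.<⇒≤ α<1)) (ℚP.nonNegative⁻¹ ⅓)

  α-β-nonNeg : ∀ {α} → ½ < α → 0ℚ ≤ α - β α
  α-β-nonNeg {α} ½<α = subst (0ℚ ≤_) (sym (rearrange α))
    (ℚP.+-mono-≤ (*-nonNeg (p≤q⇒0≤q-p (ℚP.<⇒≤ ½<α)) (ℚP.nonNegative⁻¹ (fromℕ 4 * ⅓))) (ℚP.nonNegative⁻¹ ⅓))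
    where
    rearrange : ∀ α → α - (1ℚ - α) * ⅓ ≡ (α - ½) * (fromℕ 4 * ⅓) + ⅓
    rearrange = solve-∀ ℚ-ring

  1-α≢0 : ∀ {α} → α < 1ℚ → 1ℚ - α ≢ 0ℚ
  1-α≢0 {α} α<1 1-α≡0 = ℚP.<-irrefl (sym 1-α≡0) (subst (_< 1ℚ - α) (ℚP.+-inverseʳ α) (ℚP.+-monoˡ-< (- α) α<1))

  module MatchedNeighbourhoods
    {x y a₁ a₂ b₁ b₂ : V} (Nx : NeighbourhoodIs x y a₁ a₂) (Ny : NeighbourhoodIs y x b₁ b₂)
    {k₁ k₂ : ℕ} (a₁b₁≤k₁ : dist a₁ b₁ ℕ.≤ k₁) (a₂b₂≤k₂ : dist a₂ b₂ ℕ.≤ k₂)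
    (φ : V → ℕ) (φ-lip : ∀ u v → φ v ℕ.≤ φ u ℕ.+ dist u v)
    (φ-y : φ y ≡ suc (φ x)) (φ-b₁ : φ b₁ ≡ φ a₁ ℕ.+ k₁) (φ-b₂ : φ b₂ ≡ φ a₂ ℕ.+ k₂)
    where

    dist-xy : dist x y ≡ 1
    dist-xy = ℕP.≤-antisym (dist-adj-≤ x y (adj-first Nx))
      (ℕP.+-cancelˡ-≤ (φ x) 1 (dist x y) (subst (ℕ._≤ φ x ℕ.+ dist x y) (trans φ-y (ℕP.+-comm 1 (φ x))) (φ-lip x y)))

    W₁ : ℚ → ℚ
    W₁ α = α - β α + β α * (fromℕ k₁ + fromℕ k₂)

    plan : ℚ → Plan
    plan α = (x , x , β α) ∷ (x , y , α - β α) ∷ (y , y , β α) ∷ (a₁ , b₁ , β α) ∷ (a₂ , b₂ , β α) ∷ []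

    f : V → ℚ
    f v = fromℕ (φ v)

    f-lip : ∀ u v → f v ≤ f u + distℚ u v
    f-lip u v = subst (f v ≤_) (fromℕ-+ (φ u) (dist u v)) (fromℕ-mono-≤ (φ-lip u v))

    plan-cost : ∀ α → ½ < α → α < 1ℚ → transportCost (plan α) ≤ W₁ α
    plan-cost α ½<α α<1 = ℚP.≤-trans
      (ℚP.+-mono-≤ (scale β≥0 (ℕP.≤-reflexive (dist-self x)))
      (ℚP.+-mono-≤ (scale (α-β-nonNeg ½<α) (dist-adj-≤ x y (adj-first Nx)))
      (ℚP.+-mono-≤ (scale β≥0 (ℕP.≤-reflexive (dist-self y)))
      (ℚP.+-mono-≤ (scale β≥0 a₁b₁≤k₁)
      (ℚP.+-mono-≤ (scale β≥0 a₂b₂≤k₂) ℚP.≤-refl)))))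
      (ℚP.≤-reflexive (total α (β α) (fromℕ k₁) (fromℕ k₂)))
      where
      β≥0 : 0ℚ ≤ β α
      β≥0 = β-nonNeg α<1
      scale : ∀ {u v k c} → 0ℚ ≤ c → dist u v ℕ.≤ k → distℚ u v * c ≤ fromℕ k * c
      scale {c = c} 0≤c d≤k = ℚP.*-monoʳ-≤-nonNeg c {{ℚ.nonNegative 0≤c}} (fromℕ-mono-≤ d≤k)
      total : ∀ α β K₁ K₂ → fromℕ 0 * β + (fromℕ 1 * (α - β) + (fromℕ 0 * β + (K₁ * β + (K₂ * β + 0ℚ))))
                          ≡ α - β + β * (K₁ + K₂)
      total = solve-∀ ℚ-ring

    potential-gap : ∀ α → Σ[ (λ u → f u * μ α x u) ] + W₁ α ≡ Σ[ (λ v → f v * μ α y v) ]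
    potential-gap α = begin
      Σ[ (λ u → f u * μ α x u) ] + W₁ α
        ≡⟨ cong (_+ W₁ α) (Σ-*-μ Nx f α) ⟩
      α * f x + (β α * f y + (β α * f a₁ + (β α * f a₂ + 0ℚ))) + W₁ α
        ≡⟨ cong (λ fy → α * f x + (β α * fy + (β α * f a₁ + (β α * f a₂ + 0ℚ))) + W₁ α) f-y ⟩
      α * f x + (β α * (1ℚ + f x) + (β α * f a₁ + (β α * f a₂ + 0ℚ))) + W₁ α
        ≡⟨ balance α (β α) (f x) (f a₁) (f a₂) (fromℕ k₁) (fromℕ k₂) ⟩
      α * (1ℚ + f x) + (β α * f x + (β α * (f a₁ + fromℕ k₁) + (β α * (f a₂ + fromℕ k₂) + 0ℚ)))
        ≡⟨ cong₂ (λ fy fb → α * fy + (β α * f x + fb)) (sym f-y)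
                 (cong₂ (λ fb₁ fb₂ → β α * fb₁ + (β α * fb₂ + 0ℚ)) (sym (f-b φ-b₁)) (sym (f-b φ-b₂))) ⟩
      α * f y + (β α * f x + (β α * f b₁ + (β α * f b₂ + 0ℚ)))
        ≡⟨ Σ-*-μ Ny f α ⟨
      Σ[ (λ v → f v * μ α y v) ] ∎
      where
      open ≡-Reasoning
      f-y : f y ≡ 1ℚ + f x
      f-y = trans (cong fromℕ φ-y) (fromℕ-+ 1 (φ x))
      f-b : ∀ {a b k} → φ b ≡ φ a ℕ.+ k → f b ≡ f a + fromℕ k
      f-b {a} {k = k} φ-b = trans (cong fromℕ φ-b) (fromℕ-+ (φ a) k)
      balance : ∀ α β X A₁ A₂ K₁ K₂ →
        α * X + (β * (1ℚ + X) + (β * A₁ + (β * A₂ + 0ℚ))) + (α - β + β * (K₁ + K₂)) ≡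
        α * (1ℚ + X) + (β * X + (β * (A₁ + K₁) + (β * (A₂ + K₂) + 0ℚ)))
      balance = solve-∀ ℚ-ring

    isW1 : ∀ α → ½ < α → α < 1ℚ → IsW1 (μ α x) (μ α y) (W₁ α)
    isW1 α ½<α α<1 = isW1-of-plan (W₁ α) (plan α) f weights≥0 sources≡μx targets≡μy
                                           (plan-cost α ½<α α<1) f-lip (ℚP.≤-reflexive (potential-gap α))
      where
      β≥0 : 0ℚ ≤ β α
      β≥0 = β-nonNeg α<1
      weights≥0 : NonNegWeights (plan α)
      weights≥0 = β≥0 ∷ α-β-nonNeg ½<α ∷ β≥0 ∷ β≥0 ∷ β≥0 ∷ []
      merge : ∀ α β X Y A₁ A₂ →
        β * X + ((α - β) * X + (β * Y + (β * A₁ + (β * A₂ + 0ℚ)))) ≡ α * X + (β * Y + (β * A₁ + (β * A₂ + 0ℚ)))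
      merge = solve-∀ ℚ-ring
      reorder : ∀ α β X Y B₁ B₂ →
        β * X + ((α - β) * Y + (β * Y + (β * B₁ + (β * B₂ + 0ℚ)))) ≡ α * Y + (β * X + (β * B₁ + (β * B₂ + 0ℚ)))
      reorder = solve-∀ ℚ-ring
      sources≡μx : ∀ u → density (sources (plan α)) u ≡ μ α x u
      sources≡μx u = trans (merge α (β α) (𝟙[ x ] u) (𝟙[ y ] u) (𝟙[ a₁ ] u) (𝟙[ a₂ ] u))
                           (sym (μ-neighbourhood Nx α u))
      targets≡μy : ∀ v → density (targets (plan α)) v ≡ μ α y v
      targets≡μy v = trans (reorder α (β α) (𝟙[ x ] v) (𝟙[ y ] v) (𝟙[ b₁ ] v) (𝟙[ b₂ ] v))
                           (sym (μ-neighbourhood Ny α v))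

    κ : ℚ
    κ = (fromℕ 4 - fromℕ k₁ - fromℕ k₂) * ⅓

    kappaα≡κ : ∀ α → α < 1ℚ → kappaα x y (W₁ α) ÷? (1ℚ - α) ≡ κ
    kappaα≡κ α α<1 = begin
      (1ℚ - W₁ α ÷? fromℕ (dist x y)) ÷? (1ℚ - α)  ≡⟨ cong (λ d → (1ℚ - W₁ α ÷? fromℕ d) ÷? (1ℚ - α)) dist-xy ⟩
      (1ℚ - W₁ α ÷? fromℕ 1) ÷? (1ℚ - α)           ≡⟨ cong (_÷? (1ℚ - α)) (curvature α (fromℕ k₁) (fromℕ k₂)) ⟩
      (κ * (1ℚ - α)) ÷? (1ℚ - α)                   ≡⟨ ÷?-cancelʳ κ (1ℚ - α) (1-α≢0 α<1) ⟩
      κ                                             ∎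
      where
      open ≡-Reasoning
      curvature : ∀ α K₁ K₂ → 1ℚ - (α - (1ℚ - α) * ⅓ + (1ℚ - α) * ⅓ * (K₁ + K₂)) * 1ℚ
                              ≡ (fromℕ 4 - K₁ - K₂) * ⅓ * (1ℚ - α)
      curvature = solve-∀ ℚ-ring

    ricciIs : RicciIs x y κ
    ricciIs = ricciIs-of-exact x y κ (λ α ½<α α<1 → W₁ α , isW1 α ½<α α<1 , kappaα≡κ α α<1)

-- The instance argument and the pattern 6+ m (instead of a defined n) keep the types of
-- ricci-σ and ricci-τ syntactically equal to those in theorem2: comparing them only up
-- to conversion makes Agda normalise the Ricci condition at concrete vertices.
module DihedralCycle (m : ℕ) .{{n≢0 : NonZero (6+ m)}} where

  open import Function using (_∘_)
  open import Data.Bool using (Bool; true; false; not; _∨_; _xor_; if_then_else_)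
  import Data.Bool.Properties as BoolP
  open import Data.Nat as ℕ using (ℕ; zero; suc; _∸_; _⊓_; z≤n; s≤s)
  import Data.Nat.Properties as ℕP
  open import Data.Nat.DivMod using (_mod_; _%_; %-distribˡ-+; m%n%n≡m%n; [m+n]%n≡m%n; m<n⇒m%n≡m; n%n≡0; m%n<n)
  open import Data.Fin using (Fin; toℕ)
  import Data.Fin.Properties as Fin
  open import Data.Integer using (+_)
  open import Data.Rational using (0ℚ; _/_)
  open import Data.List using ([]; _∷_; length)
  open import Data.List.Relation.Unary.All using ([]; _∷_)
  open import Data.List.Relation.Unary.AllPairs using ([]; _∷_)
  open import Data.List.Relation.Unary.Unique.Propositional using (Unique)
  import Data.List.Relation.Unary.Unique.Propositional.Properties as Unique
  open import Data.Product using (_×_; _,_; proj₁; proj₂)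
  open import Data.Sum using (inj₁; inj₂)
  open import Relation.Nullary using (⌊_⌋)
  open import Relation.Binary.PropositionalEquality

  open Dihedral (6+ m) {{n≢0}} public

  toℕ-mod : ∀ k → toℕ (k mod 6+ m) ≡ k % 6+ m
  toℕ-mod k = Fin.toℕ-fromℕ< _

  %-absorbˡ : ∀ a b → (a % 6+ m ℕ.+ b) % 6+ m ≡ (a ℕ.+ b) % 6+ m
  %-absorbˡ a b = begin
    (a % 6+ m ℕ.+ b) % 6+ m            ≡⟨ %-distribˡ-+ (a % 6+ m) b (6+ m) ⟩
    (a % 6+ m % 6+ m ℕ.+ b % 6+ m) % 6+ m    ≡⟨ cong (λ r → (r ℕ.+ b % 6+ m) % 6+ m) (m%n%n≡m%n a (6+ m)) ⟩
    (a % 6+ m ℕ.+ b % 6+ m) % 6+ m        ≡⟨ %-distribˡ-+ a b (6+ m) ⟨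
    (a ℕ.+ b) % 6+ m                ∎
    where open ≡-Reasoning

  %-absorbʳ : ∀ a b → (a ℕ.+ b % 6+ m) % 6+ m ≡ (a ℕ.+ b) % 6+ m
  %-absorbʳ a b = trans (cong (_% 6+ m) (ℕP.+-comm a (b % 6+ m)))
                        (trans (%-absorbˡ b a) (cong (_% 6+ m) (ℕP.+-comm b a)))

  5+m : ℕ
  5+m = suc (suc (suc (suc (suc m))))

  next prev : Fin (6+ m) → Fin (6+ m)
  next j = (toℕ j ℕ.+ 1) mod 6+ m
  prev j = (toℕ j ℕ.+ 5+m) mod 6+ m

  [toℕ+n]%n≡toℕ : ∀ (j : Fin (6+ m)) → (toℕ j ℕ.+ (6+ m)) % 6+ m ≡ toℕ j
  [toℕ+n]%n≡toℕ j = trans ([m+n]%n≡m%n (toℕ j) (6+ m)) (m<n⇒m%n≡m (Fin.toℕ<n j))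

  next-prev : ∀ j → next (prev j) ≡ j
  next-prev j = Fin.toℕ-injective (begin
    toℕ (next (prev j))                  ≡⟨ toℕ-mod (toℕ (prev j) ℕ.+ 1) ⟩
    (toℕ (prev j) ℕ.+ 1) % 6+ m          ≡⟨ cong (λ r → (r ℕ.+ 1) % 6+ m) (toℕ-mod (toℕ j ℕ.+ 5+m)) ⟩
    ((toℕ j ℕ.+ 5+m) % 6+ m ℕ.+ 1) % 6+ m ≡⟨ %-absorbˡ (toℕ j ℕ.+ 5+m) 1 ⟩
    (toℕ j ℕ.+ 5+m ℕ.+ 1) % 6+ m         ≡⟨ cong (_% 6+ m) (ℕP.+-assoc (toℕ j) 5+m 1) ⟩
    (toℕ j ℕ.+ (5+m ℕ.+ 1)) % 6+ m       ≡⟨ cong (λ r → (toℕ j ℕ.+ r) % 6+ m) (ℕP.+-comm 5+m 1) ⟩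
    (toℕ j ℕ.+ 6+ m) % 6+ m              ≡⟨ [toℕ+n]%n≡toℕ j ⟩
    toℕ j                                ∎)
    where open ≡-Reasoning

  prev-next : ∀ j → prev (next j) ≡ j
  prev-next j = Fin.toℕ-injective (begin
    toℕ (prev (next j))                  ≡⟨ toℕ-mod (toℕ (next j) ℕ.+ 5+m) ⟩
    (toℕ (next j) ℕ.+ 5+m) % 6+ m        ≡⟨ cong (λ r → (r ℕ.+ 5+m) % 6+ m) (toℕ-mod (toℕ j ℕ.+ 1)) ⟩
    ((toℕ j ℕ.+ 1) % 6+ m ℕ.+ 5+m) % 6+ m ≡⟨ %-absorbˡ (toℕ j ℕ.+ 1) 5+m ⟩
    (toℕ j ℕ.+ 1 ℕ.+ 5+m) % 6+ m         ≡⟨ cong (_% 6+ m) (ℕP.+-assoc (toℕ j) 1 5+m) ⟩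
    (toℕ j ℕ.+ 6+ m) % 6+ m              ≡⟨ [toℕ+n]%n≡toℕ j ⟩
    toℕ j                                ∎)
    where open ≡-Reasoning

  toℕ-σ⁻¹ : toℕ (proj₁ (σ ⁻¹)) ≡ 5+m
  toℕ-σ⁻¹ = trans (toℕ-mod 5+m) (m<n⇒m%n≡m (ℕP.n<1+n 5+m))

  forward backward : Bool → Fin (6+ m) → Fin (6+ m)
  forward false = next
  forward true  = prev
  backward c = forward (not c)

  ·σ : ∀ j c → (j , c) · σ ≡ (forward c j , c)
  ·σ j false = refl
  ·σ j true  = refl

  ·σ⁻¹ : ∀ j c → (j , c) · (σ ⁻¹) ≡ (backward c j , c)
  ·σ⁻¹ j false = cong (λ k → ((toℕ j ℕ.+ k) mod 6+ m , false)) toℕ-σ⁻¹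
  ·σ⁻¹ j true  = trans (cong (λ k → ((toℕ j ℕ.+ (6+ m ∸ k)) mod 6+ m , true)) toℕ-σ⁻¹)
                       (cong (λ k → ((toℕ j ℕ.+ k) mod 6+ m , true)) (ℕP.m+n∸n≡m 1 m))

  ·τ : ∀ j c → (j , c) · τ ≡ (j , not c)
  ·τ j false = cong (_, true) (Fin.toℕ-injective (trans (toℕ-mod (toℕ j ℕ.+ 0))
                 (trans (cong (_% 6+ m) (ℕP.+-identityʳ (toℕ j))) (m<n⇒m%n≡m (Fin.toℕ<n j)))))
  ·τ j true  = cong (_, false) (Fin.toℕ-injective (trans (toℕ-mod (toℕ j ℕ.+ (6+ m))) ([toℕ+n]%n≡toℕ j)))

  offset : Fin (6+ m) → Fin (6+ m) → ℕ
  offset a j = (toℕ j ℕ.+ (6+ m ∸ toℕ a)) % 6+ m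

  offset-self : ∀ a → offset a a ≡ 0
  offset-self a = trans (cong (_% 6+ m) (ℕP.m+[n∸m]≡n (ℕP.<⇒≤ (Fin.toℕ<n a)))) (n%n≡0 (6+ m))

  offset-next : ∀ a j → offset a (next j) ≡ suc (offset a j) % 6+ m
  offset-next a j = begin
    (toℕ (next j) ℕ.+ d) % 6+ m            ≡⟨ cong (λ r → (r ℕ.+ d) % 6+ m) (toℕ-mod (toℕ j ℕ.+ 1)) ⟩
    ((toℕ j ℕ.+ 1) % 6+ m ℕ.+ d) % 6+ m       ≡⟨ %-absorbˡ (toℕ j ℕ.+ 1) d ⟩
    (toℕ j ℕ.+ 1 ℕ.+ d) % 6+ m             ≡⟨ cong (_% 6+ m) (trans (ℕP.+-assoc (toℕ j) 1 d) (ℕP.+-suc (toℕ j) d)) ⟩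
    suc (toℕ j ℕ.+ d) % 6+ m               ≡⟨ %-absorbʳ 1 (toℕ j ℕ.+ d) ⟨
    suc (offset a j) % 6+ m                ∎
    where
    open ≡-Reasoning
    d = (6+ m) ∸ toℕ a

  offset-prev : ∀ a j → offset a j ≡ suc (offset a (prev j)) % 6+ m
  offset-prev a j = trans (cong (offset a) (sym (next-prev j))) (offset-next a (prev j))

  offset-next-≡ : ∀ a j {k} → offset a j ≡ k → offset a (next j) ≡ suc k % 6+ m
  offset-next-≡ a j refl = offset-next a j

  offset-prev-≡ : ∀ a j {k} → offset a (prev j) ≡ k → offset a j ≡ suc k % 6+ m
  offset-prev-≡ a j refl = offset-prev a j

  next≢id : ∀ j → next j ≢ j
  next≢id j next-j≡j = ℕP.1+n≢0 (begin
    1                   ≡⟨ offset-next-≡ j j (offset-self j) ⟨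
    offset j (next j)   ≡⟨ cong (offset j) next-j≡j ⟩
    offset j j          ≡⟨ offset-self j ⟩
    0                   ∎)
    where open ≡-Reasoning

  next-next≢id : ∀ j → next (next j) ≢ j
  next-next≢id j next²-j≡j = ℕP.1+n≢0 (begin
    2                          ≡⟨ offset-next-≡ j (next j) (offset-next-≡ j j (offset-self j)) ⟨
    offset j (next (next j))   ≡⟨ cong (offset j) next²-j≡j ⟩
    offset j j                 ≡⟨ offset-self j ⟩
    0                          ∎)
    where open ≡-Reasoning

  prev≢id : ∀ j → prev j ≢ j
  prev≢id j prev-j≡j = next≢id j (trans (cong next (sym prev-j≡j)) (next-prev j))

  next≢prev : ∀ j → next j ≢ prev j
  next≢prev j eq = next-next≢id j (trans (cong next eq) (next-prev j))

  forward≢id : ∀ c j → forward c j ≢ j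
  forward≢id false = next≢id
  forward≢id true  = prev≢id

  forward≢backward : ∀ c j → forward c j ≢ backward c j
  forward≢backward false j = next≢prev j
  forward≢backward true  j = next≢prev j ∘ sym

  vertices-unique : Unique (FinGraph.vertices Γ)
  vertices-unique = Unique.cartesianProduct⁺ (Unique.allFin⁺ (6+ m)) (((λ ()) ∷ []) ∷ [] ∷ [])

  open FinGraph Γ using (adj; vertices; _≟V_)
  open GraphNotions Γ using (RicciIs; dist)
  open Transport Γ vertices-unique

  neighbourhood : ∀ j c → NeighbourhoodIs (j , c) (forward c j , c) (backward c j , c) (j , not c)
  neighbourhood j c = record
    { adj≡ = adj≡ (·σ j c) (·σ⁻¹ j c) (·τ j c)
    ; x≢a = forward≢id c j ∘ sym ∘ cong proj₁
    ; x≢b = forward≢id (not c) j ∘ sym ∘ cong proj₁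
    ; x≢c = BoolP.not-¬ refl ∘ cong proj₂
    ; a≢b = forward≢backward c j ∘ cong proj₁
    ; a≢c = BoolP.not-¬ refl ∘ cong proj₂
    ; b≢c = BoolP.not-¬ refl ∘ cong proj₂
    }
    where
    adj≡ : ∀ {a b c'} → (j , c) · σ ≡ a → (j , c) · (σ ⁻¹) ≡ b → (j , c) · τ ≡ c' →
           ∀ v → adj (j , c) v ≡ ⌊ v ≟V a ⌋ ∨ ⌊ v ≟V b ⌋ ∨ ⌊ v ≟V c' ⌋
    adj≡ {a} {b} {c'} refl refl refl v =
      cong (λ t → ⌊ v ≟V a ⌋ ∨ ⌊ v ≟V b ⌋ ∨ t) (repeated ⌊ v ≟V c' ⌋)
      where
      repeated : ∀ p → p ∨ p ∨ false ≡ p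
      repeated p = trans (cong (p ∨_) (BoolP.∨-identityʳ p)) (BoolP.∨-idem p)

  cappedDist : ℕ → ℕ
  cappedDist k = k ⊓ (6+ m ∸ k) ⊓ 3

  cappedDist≤3 : ∀ k → cappedDist k ℕ.≤ 3
  cappedDist≤3 k = ℕP.m⊓n≤n _ 3

  ∸-suc-≤ : ∀ a k → a ∸ k ℕ.≤ suc (a ∸ suc k)
  ∸-suc-≤ zero    zero    = z≤n
  ∸-suc-≤ zero    (suc k) = z≤n
  ∸-suc-≤ (suc a) zero    = ℕP.≤-refl
  ∸-suc-≤ (suc a) (suc k) = ∸-suc-≤ a k

  Close : ℕ → ℕ → Set
  Close k r = cappedDist r ℕ.≤ suc (cappedDist k) × cappedDist k ℕ.≤ suc (cappedDist r)

  cappedDist-step : ∀ {k} → k ℕ.< 6+ m → Close k (suc k % 6+ m)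
  cappedDist-step {k} k<n with ℕP.m≤n⇒m<n∨m≡n k<n
  ... | inj₁ k+1<n = subst (Close k) (sym (m<n⇒m%n≡m k+1<n)) (up , down)
    where
    up : cappedDist (suc k) ℕ.≤ suc k ⊓ suc (6+ m ∸ k) ⊓ 4
    up = ℕP.⊓-mono-≤ (ℕP.⊓-mono-≤ ℕP.≤-refl (ℕP.≤-trans (ℕP.∸-monoʳ-≤ (6+ m) (ℕP.n≤1+n k)) (ℕP.n≤1+n _)))
                     (ℕP.n≤1+n 3)
    down : cappedDist k ℕ.≤ suc (suc k) ⊓ suc (6+ m ∸ suc k) ⊓ 4
    down = ℕP.⊓-mono-≤ (ℕP.⊓-mono-≤ (ℕP.≤-trans (ℕP.n≤1+n k) (ℕP.n≤1+n _)) (∸-suc-≤ (6+ m) k)) (ℕP.n≤1+n 3)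
  ... | inj₂ k+1≡n = subst (Close k) (sym wrap) (z≤n , at-end)
    where
    wrap : suc k % 6+ m ≡ 0
    wrap = trans (cong (_% 6+ m) k+1≡n) (n%n≡0 (6+ m))
    at-end : cappedDist k ℕ.≤ 1
    at-end = ℕP.≤-trans (ℕP.≤-trans (ℕP.m⊓n≤m _ 3) (ℕP.m⊓n≤n k (6+ m ∸ k)))
                        (ℕP.≤-reflexive (trans (cong (_∸ k) (sym k+1≡n)) (ℕP.m+n∸n≡m 1 k)))

  CycleLipschitz : (Fin (6+ m) → ℕ) → Set
  CycleLipschitz g = ∀ j → g (next j) ℕ.≤ suc (g j) × g (prev j) ℕ.≤ suc (g j)

  cappedDist-lipschitz : ∀ a → CycleLipschitz (cappedDist ∘ offset a)
  cappedDist-lipschitz a j =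
    subst (λ r → cappedDist r ℕ.≤ suc (cappedDist (offset a j)))
          (sym (offset-next a j)) (proj₁ (cappedDist-step (offset<n j))) ,
    subst (λ r → cappedDist (offset a (prev j)) ℕ.≤ suc (cappedDist r))
          (sym (offset-prev a j)) (proj₂ (cappedDist-step (offset<n (prev j))))
    where
    offset<n : ∀ j → offset a j ℕ.< 6+ m
    offset<n j = m%n<n (toℕ j ℕ.+ (6+ m ∸ toℕ a)) (6+ m)

  ∸-lipschitz : ∀ c {g} → CycleLipschitz g → CycleLipschitz (λ j → c ∸ g j)
  ∸-lipschitz c {g} g-lip j =
    reverse (subst (λ i → g i ℕ.≤ suc (g (next j))) (prev-next j) (proj₂ (g-lip (next j)))) ,
    reverse (subst (λ i → g i ℕ.≤ suc (g (prev j))) (next-prev j) (proj₁ (g-lip (prev j))))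
    where
    reverse : ∀ {a b} → a ℕ.≤ suc b → c ∸ b ℕ.≤ suc (c ∸ a)
    reverse {a} {b} a≤1+b = ℕP.m≤n+o⇒m∸n≤o c b (begin
      c                    ≤⟨ ℕP.m≤n+m∸n c a ⟩
      a ℕ.+ (c ∸ a)        ≤⟨ ℕP.+-monoˡ-≤ (c ∸ a) a≤1+b ⟩
      suc b ℕ.+ (c ∸ a)    ≡⟨ ℕP.+-suc b (c ∸ a) ⟨
      b ℕ.+ suc (c ∸ a)    ∎)
      where open ℕP.≤-Reasoning

  forward-lipschitz : ∀ {g} → CycleLipschitz g → ∀ c j → g (forward c j) ℕ.≤ suc (g j)
  forward-lipschitz g-lip false j = proj₁ (g-lip j)
  forward-lipschitz g-lip true  j = proj₂ (g-lip j)

  sideDistance : Bool → Bool → ℕ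
  sideDistance b c = if b xor c then 1 else 0

  sideDistance-≤1 : ∀ b c → sideDistance b c ℕ.≤ 1
  sideDistance-≤1 b c with b xor c
  ... | true  = ℕP.≤-refl
  ... | false = z≤n

  potential : (Fin (6+ m) → ℕ) → Bool → D → ℕ
  potential g b (j , c) = g j ℕ.+ sideDistance b c

  potential-edge : ∀ {g} b → CycleLipschitz g → ∀ {u v} → adj u v ≡ true → potential g b v ℕ.≤ suc (potential g b u)
  potential-edge {g} b g-lip {j , c} {v} j,c~v with adj⇒neighbour (neighbourhood j c) {v} j,c~v
  ... | inj₁ refl        = ℕP.+-monoˡ-≤ (sideDistance b c) (forward-lipschitz g-lip c j)
  ... | inj₂ (inj₁ refl) = ℕP.+-monoˡ-≤ (sideDistance b c) (forward-lipschitz g-lip (not c) j)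
  ... | inj₂ (inj₂ refl) = begin
    g j ℕ.+ sideDistance b (not c)   ≤⟨ ℕP.+-monoʳ-≤ (g j) (sideDistance-≤1 b (not c)) ⟩
    g j ℕ.+ 1                        ≡⟨ ℕP.+-comm (g j) 1 ⟩
    suc (g j)                        ≤⟨ s≤s (ℕP.m≤m+n (g j) (sideDistance b c)) ⟩
    suc (g j ℕ.+ sideDistance b c)   ∎
    where open ℕP.≤-Reasoning

  potential-lipschitz : ∀ {g} b → CycleLipschitz g → (∀ j → g j ℕ.≤ 3) →
                        ∀ u v → potential g b v ℕ.≤ potential g b u ℕ.+ dist u v
  potential-lipschitz {g} b g-lip g≤3 = φ-≤-dist (potential g b) (potential-edge b g-lip) bounded
    where
    bounded : ∀ v → potential g b v ℕ.≤ length vertices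
    bounded (j , c) = ℕP.≤-trans (ℕP.+-mono-≤ (g≤3 j) (sideDistance-≤1 b c)) (s≤s (s≤s (s≤s (s≤s z≤n))))

  three≤|V| : 3 ℕ.≤ length vertices
  three≤|V| = s≤s (s≤s (s≤s z≤n))

  ricci-σ-rotation : ∀ i → RicciIs (i , false) (next i , false) 0ℚ
  ricci-σ-rotation i = MatchedNeighbourhoods.ricciIs Nx Ny a₁b₁≤3 a₂b₂≤1
    φ (potential-lipschitz false (cappedDist-lipschitz (prev i)) (cappedDist≤3 ∘ offset (prev i)))
    (trans (φ-at (next i) false o-y) (sym (cong suc (φ-at i false o-x))))
    (trans (φ-at (next (next i)) false o-b₁) (sym (cong (ℕ._+ 3) (φ-at (prev i) false o-a₁))))
    (trans (φ-at (next i) true o-y) (sym (cong (ℕ._+ 1) (φ-at i true o-x))))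
    where
    Nx : NeighbourhoodIs (i , false) (next i , false) (prev i , false) (i , true)
    Nx = neighbourhood i false
    Ny : NeighbourhoodIs (next i , false) (i , false) (next (next i) , false) (next i , true)
    Ny = swap₁₂ (subst (λ j → NeighbourhoodIs (next i , false) (next (next i) , false) (j , false) (next i , true))
                       (prev-next i) (neighbourhood (next i) false))
    a₁b₁≤3 : dist (prev i , false) (next (next i) , false) ℕ.≤ 3
    a₁b₁≤3 = dist-≤-walk ([ prev i , false ]
      —[ subst (λ j → adj (prev i , false) (j , false) ≡ true) (next-prev i)
               (adj-first (neighbourhood (prev i) false)) ]→ (i , false)
      —[ adj-first Nx ]→ (next i , false)
      —[ adj-first (neighbourhood (next i) false) ]→ (next (next i) , false)) three≤|V|
    a₂b₂≤1 : dist (i , true) (next i , true) ℕ.≤ 1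
    a₂b₂≤1 = dist-adj-≤ (i , true) (next i , true) (adj-first (swap₁₂ (neighbourhood i true)))
    φ : D → ℕ
    φ = potential (cappedDist ∘ offset (prev i)) false
    φ-at : ∀ j {k} c → offset (prev i) j ≡ k → φ (j , c) ≡ cappedDist k ℕ.+ sideDistance false c
    φ-at j c o = cong (λ k → cappedDist k ℕ.+ sideDistance false c) o
    o-a₁ : offset (prev i) (prev i) ≡ 0
    o-a₁ = offset-self (prev i)
    o-x : offset (prev i) i ≡ 1
    o-x = offset-prev-≡ (prev i) i o-a₁
    o-y : offset (prev i) (next i) ≡ 2
    o-y = offset-next-≡ (prev i) i o-x
    o-b₁ : offset (prev i) (next (next i)) ≡ 3
    o-b₁ = offset-next-≡ (prev i) (next i) o-y

  -- On reflections σ runs backwards along the cycle, so the potential is anchored at the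
  -- far end b₁ and reversed.
  ricci-σ-reflection : ∀ i → RicciIs (i , true) (prev i , true) 0ℚ
  ricci-σ-reflection i = MatchedNeighbourhoods.ricciIs Nx Ny a₁b₁≤3 a₂b₂≤1
    φ (potential-lipschitz true (∸-lipschitz 3 (cappedDist-lipschitz (prev (prev i))))
                                (λ j → ℕP.m∸n≤m 3 (cappedDist (offset (prev (prev i)) j))))
    (trans (φ-at (prev i) true o-y) (sym (cong suc (φ-at i true o-x))))
    (trans (φ-at (prev (prev i)) true o-b₁) (sym (cong (ℕ._+ 3) (φ-at (next i) true o-a₁))))
    (trans (φ-at (prev i) false o-y) (sym (cong (ℕ._+ 1) (φ-at i false o-x))))
    where
    Nx : NeighbourhoodIs (i , true) (prev i , true) (next i , true) (i , false)
    Nx = neighbourhood i true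
    Ny : NeighbourhoodIs (prev i , true) (i , true) (prev (prev i) , true) (prev i , false)
    Ny = swap₁₂ (subst (λ j → NeighbourhoodIs (prev i , true) (prev (prev i) , true) (j , true) (prev i , false))
                       (next-prev i) (neighbourhood (prev i) true))
    a₁b₁≤3 : dist (next i , true) (prev (prev i) , true) ℕ.≤ 3
    a₁b₁≤3 = dist-≤-walk ([ next i , true ]
      —[ subst (λ j → adj (next i , true) (j , true) ≡ true) (prev-next i)
               (adj-first (neighbourhood (next i) true)) ]→ (i , true)
      —[ adj-first Nx ]→ (prev i , true)
      —[ adj-first (neighbourhood (prev i) true) ]→ (prev (prev i) , true)) three≤|V|
    a₂b₂≤1 : dist (i , false) (prev i , false) ℕ.≤ 1
    a₂b₂≤1 = dist-adj-≤ (i , false) (prev i , false) (adj-first (swap₁₂ (neighbourhood i false)))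
    φ : D → ℕ
    φ = potential (λ j → 3 ∸ cappedDist (offset (prev (prev i)) j)) true
    φ-at : ∀ j {k} c → offset (prev (prev i)) j ≡ k → φ (j , c) ≡ 3 ∸ cappedDist k ℕ.+ sideDistance true c
    φ-at j c o = cong (λ k → 3 ∸ cappedDist k ℕ.+ sideDistance true c) o
    o-b₁ : offset (prev (prev i)) (prev (prev i)) ≡ 0
    o-b₁ = offset-self (prev (prev i))
    o-y : offset (prev (prev i)) (prev i) ≡ 1
    o-y = offset-prev-≡ (prev (prev i)) (prev i) o-b₁
    o-x : offset (prev (prev i)) i ≡ 2
    o-x = offset-prev-≡ (prev (prev i)) i o-y
    o-a₁ : offset (prev (prev i)) (next i) ≡ 3
    o-a₁ = offset-next-≡ (prev (prev i)) i o-x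

  neighbourhood-across : ∀ i b → NeighbourhoodIs (i , not b) (backward b i , not b) (forward b i , not b) (i , b)
  neighbourhood-across i false = neighbourhood i true
  neighbourhood-across i true  = neighbourhood i false

  sideDistance-across : ∀ b → sideDistance b (not b) ≡ suc (sideDistance b b)
  sideDistance-across false = refl
  sideDistance-across true  = refl

  ricci-τ-edge : ∀ i b → RicciIs (i , b) (i , not b) (+ 2 / 3)
  ricci-τ-edge i b = MatchedNeighbourhoods.ricciIs Nx Ny (across (forward b i)) (across (backward b i))
    (potential (λ _ → 0) b) (potential-lipschitz b (λ _ → z≤n , z≤n) (λ _ → z≤n))
    (sideDistance-across b) φ-across φ-across
    where
    Nx : NeighbourhoodIs (i , b) (i , not b) (forward b i , b) (backward b i , b)
    Nx = rotate (neighbourhood i b)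
    Ny : NeighbourhoodIs (i , not b) (i , b) (forward b i , not b) (backward b i , not b)
    Ny = rotate (swap₁₂ (neighbourhood-across i b))
    across : ∀ j → dist (j , b) (j , not b) ℕ.≤ 1
    across j = dist-adj-≤ (j , b) (j , not b) (adj-first (rotate (neighbourhood j b)))
    φ-across : sideDistance b (not b) ≡ sideDistance b b ℕ.+ 1
    φ-across = trans (sideDistance-across b) (ℕP.+-comm 1 (sideDistance b b))

  ricci-σ : ∀ g → GraphNotions.RicciIs (Dihedral.Γ (6+ m) {{n≢0}}) g
                    (Dihedral._·_ (6+ m) {{n≢0}} g (Dihedral.σ (6+ m) {{n≢0}})) 0ℚ
  ricci-σ (i , false) = subst (λ y → RicciIs (i , false) y 0ℚ) {x = next i , false} {y = (i , false) · σ}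
                              (sym (·σ i false)) (ricci-σ-rotation i)
  ricci-σ (i , true)  = subst (λ y → RicciIs (i , true) y 0ℚ) {x = prev i , true} {y = (i , true) · σ}
                              (sym (·σ i true)) (ricci-σ-reflection i)

  ricci-τ : ∀ g → GraphNotions.RicciIs (Dihedral.Γ (6+ m) {{n≢0}}) g
                    (Dihedral._·_ (6+ m) {{n≢0}} g (Dihedral.τ (6+ m) {{n≢0}})) (+ 2 / 3)
  ricci-τ (i , b) = subst (λ y → RicciIs (i , b) y (+ 2 / 3)) {x = i , not b} {y = (i , b) · τ}
                          (sym (·τ i b)) (ricci-τ-edge i b)

open import Data.Nat using (_≤_; s≤s; z≤n)
open import Data.Product using (_×_; _,_)
open import Data.Integer using (+_)
open import Data.Rational using (0ℚ; _/_)

theorem2 : (n : ℕ) .{{_ : NonZero n}} → 6 ≤ n → (g : Dihedral.D n) →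
    GraphNotions.RicciIs (Dihedral.Γ n) g (Dihedral._·_ n g (Dihedral.σ n)) 0ℚ
    × GraphNotions.RicciIs (Dihedral.Γ n) g (Dihedral._·_ n g (Dihedral.τ n)) (+ 2 / 3)
theorem2 _ {{n≢0}} (s≤s (s≤s (s≤s (s≤s (s≤s (s≤s {n = m} z≤n)))))) g =
  DihedralCycle.ricci-σ m {{n≢0}} g , DihedralCycle.ricci-τ m {{n≢0}} g
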